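{- Let $(X,\mathcal{T},(I_i)_{i\in\mathbb{N}})$ be a computable topological space with proper characteristic relations $\mathcal{C},\mathcal{D}$. Suppose $K$ is a nonempty compact set in $(X,\mathcal{T})$ and $a,b\in\mathbb{N}$ are such that $K\subseteq J_a\cap J_b$. Then there exists $c\in\mathbb{N}$ such that $K\subseteq J_c$, $J_c\subseteq_{\mathcal{C}}J_a$ and $J_c\subseteq_{\mathcal{C}}J_b$.
   Context: Fix a computably finite valued function $j\mapsto[j]$ from $\mathbb{N}$ onto the nonempty finite subsets of $\mathbb{N}$. A computable topological space is a triple $(X,\mathcal{T},(I_i))$ with $\{I_i\}\subseteq\mathcal{T}$ a basis and c.e. sets $\mathcal{C},\mathcal{D}\subseteq\mathbb{N}^2$ such that: (1) $(i,j)\in\mathcal{D}\Rightarrow I_i\cap I_j=\emptyset$; (2) $(i,j)\in\mathcal{C}\Rightarrow I_i\subseteq I_j$; (3) for $x\neq y$ there are $i,j$ with $x\in I_i$, $y\in I_j$, $(i,j)\in\mathcal{D}$; (4) if $x\in I_i\cap I_j$ there is $k$ with $x\in I_k$, $(k,i),(k,j)\in\mathcal{C}$. They are proper if also (5) $\mathcal{D}$ is symmetric; (6) $\mathcal{C}$ is reflexive and transitive; (7) $(k,i)\in\mathcal{C}$, $(i,j)\in\mathcal{D}$ imply $(k,j)\in\mathcal{D}$. $J_j=\bigcup_{i\in[j]}I_i$; $J_a\subseteq_{\mathcal{C}}J_b$ means that for each $i\in[a]$ there is $j\in[b]$ with $(i,j)\in\mathcal{C}$. -}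

module Defs where

open import Data.Nat using (ℕ)
open import Data.Product using (Σ; ∃; ∃-syntax; _×_; _,_)
open import Data.Maybe using (Maybe; just)
open import Data.List using (List; [])
open import Data.List.Membership.Propositional using (_∈_)
open import Data.Unit using (⊤)
open import Data.Empty using (⊥)
open import Relation.Nullary using (¬_)
open import Relation.Binary.PropositionalEquality using (_≡_)

Subset : Set → Set₁
Subset X = X → Set

_⊆_ : {X : Set} → Subset X → Subset X → Set
A ⊆ B = ∀ x → A x → B x

record Topology (X : Set) : Set₁ where
  field
    Open     : Subset X → Set
    open-X   : Open (λ _ → ⊤)
    open-∩   : ∀ U V → Open U → Open V → Open (λ x → U x × V x)
    open-⋃   : (ι : Set) (U : ι → Subset X) → (∀ i → Open (U i)) →
               Open (λ x → ∃[ i ] U i x)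

-- A c.e. subset of ℕ²: the range of a (computable, i.e. Agda-definable)
-- enumeration ℕ → Maybe (ℕ × ℕ).
InRange : (ℕ → Maybe (ℕ × ℕ)) → ℕ → ℕ → Set
InRange e i j = ∃[ n ] e n ≡ just (i , j)

-- The fixed computably finite valued function j ↦ [j] from ℕ onto the
-- nonempty finite subsets of ℕ (finite subsets represented by lists).
record FiniteCoding : Set where
  field
    code     : ℕ → List ℕ
    nonempty : ∀ j → ¬ (code j ≡ [])
    onto     : (L : List ℕ) → ¬ (L ≡ []) →
               ∃[ j ] (∀ n → (n ∈ code j → n ∈ L) × (n ∈ L → n ∈ code j))

record ProperCTS (X : Set) : Set₁ where
  field
    top   : Topology X
    I     : ℕ → Subset X
  open Topology top public
  field
    I-open  : ∀ i → Open (I i)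
    I-basis : ∀ U → Open U → ∀ x → U x → ∃[ i ] (I i x × I i ⊆ U)
    enumC   : ℕ → Maybe (ℕ × ℕ)
    enumD   : ℕ → Maybe (ℕ × ℕ)
  C : ℕ → ℕ → Set
  C = InRange enumC
  D : ℕ → ℕ → Set
  D = InRange enumD
  field
    ax1 : ∀ i j → D i j → ∀ x → I i x → I j x → ⊥
    ax2 : ∀ i j → C i j → I i ⊆ I j
    ax3 : ∀ x y → ¬ (x ≡ y) → ∃[ i ] ∃[ j ] (I i x × I j y × D i j)
    ax4 : ∀ i j x → I i x → I j x → ∃[ k ] (I k x × C k i × C k j)
    ax5 : ∀ i j → D i j → D j i
    ax6-refl  : ∀ i → C i i
    ax6-trans : ∀ i j k → C i j → C j k → C i k
    ax7 : ∀ k i j → C k i → D i j → D k j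

module _ {X : Set} (S : ProperCTS X) (F : FiniteCoding) where
  open ProperCTS S
  open FiniteCoding F

  J : ℕ → Subset X
  J j x = ∃[ i ] (i ∈ code j × I i x)

  _⊆C_ : ℕ → ℕ → Set
  a ⊆C b = ∀ i → i ∈ code a → ∃[ j ] (j ∈ code b × C i j)

  Compact : Subset X → Set₁
  Compact K = (ι : Set) (U : ι → Subset X) → (∀ i → Open (U i)) →
              K ⊆ (λ x → ∃[ i ] U i x) →
              ∃[ L ] (K ⊆ (λ x → ∃[ i ] (i ∈ L × U i x)))

module Submission where

open import Defs
open import Data.Nat using (ℕ)
open import Data.Product using (Σ; ∃-syntax; _×_; _,_; proj₁; proj₂)
open import Data.List using (List; []; map)
open import Data.List.Membership.Propositional using (_∈_)
open import Data.List.Membership.Propositional.Properties using (∈-map⁺)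
open import Data.List.Relation.Unary.All as All using (All)
open import Data.List.Relation.Unary.All.Properties as All using ()
open import Relation.Nullary using (¬_)
open import Relation.Binary.PropositionalEquality using (_≡_; refl)

-- By axiom 4 every point of J_a ∩ J_b lies in a basic set I_k with k C-below
-- some member of [a] and some member of [b]. Compactness of K selects finitely
-- many such k; as K is nonempty the selection is a nonempty list, so it is [c]
-- for some c, and this c works.

module _ {X : Set} (S : ProperCTS X) (F : FiniteCoding) where
  open ProperCTS S
  open FiniteCoding F

  CBelow : ℕ → ℕ → Set
  CBelow a k = ∃[ i ] (i ∈ code a × C k i)

  ⋃I : List ℕ → Subset X
  ⋃I L x = ∃[ k ] (k ∈ L × I k x)

  J∩J⊆⋃CBelow : ∀ a b x → J S F a x × J S F b x →
                ∃[ k ] ((CBelow a k × CBelow b k) × I k x)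
  J∩J⊆⋃CBelow a b x ((i , i∈a , Iix) , (j , j∈b , Ijx)) =
    let k , Ikx , Cki , Ckj = ax4 i j x Iix Ijx
    in  k , ((i , i∈a , Cki) , (j , j∈b , Ckj)) , Ikx

  compact⇒finite-basic-subcover : (P : ℕ → Set) (K : Subset X) → Compact S F K →
    K ⊆ (λ x → ∃[ k ] (P k × I k x)) →
    ∃[ L ] (All P L × K ⊆ ⋃I L)
  compact⇒finite-basic-subcover P K compact K⊆⋃
    with compact (Σ ℕ P) (λ t → I (proj₁ t)) (λ t → I-open (proj₁ t))
                 (λ x Kx → let k , Pk , Ikx = K⊆⋃ x Kx in (k , Pk) , Ikx)
  ... | T , K⊆⋃T =
    map proj₁ T , All.map⁺ (All.tabulate (λ {t} _ → proj₂ t)) ,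
    λ x Kx → let t , t∈T , Itx = K⊆⋃T x Kx in proj₁ t , ∈-map⁺ proj₁ t∈T , Itx

  cover-of-inhabited-≢[] : ∀ {K : Subset X} L → ∃[ x ] K x → K ⊆ ⋃I L → ¬ L ≡ []
  cover-of-inhabited-≢[] L (x , Kx) K⊆⋃L refl with K⊆⋃L x Kx
  ... | _ , () , _

  ⋃I-code : (L : List ℕ) → ¬ L ≡ [] →
            ∃[ c ] (⋃I L ⊆ J S F c × (∀ {k} → k ∈ code c → k ∈ L))
  ⋃I-code L L≢[] =
    let c , code-c≈L = onto L L≢[]
    in  c , (λ { x (k , k∈L , Ikx) → k , proj₂ (code-c≈L k) k∈L , Ikx })
          , (λ {k} k∈c → proj₁ (code-c≈L k) k∈c)

  All-CBelow⇒⊆C : ∀ {a c L} → All (CBelow a) L →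
                  (∀ {k} → k ∈ code c → k ∈ L) → _⊆C_ S F c a
  All-CBelow⇒⊆C below c⊆L k k∈c = All.lookup below (c⊆L k∈c)

proposition4p2 : {X : Set} (S : ProperCTS X) (F : FiniteCoding)
    (K : Subset X) → Compact S F K → (∃[ x ] K x) →
    (a b : ℕ) → K ⊆ (λ x → J S F a x × J S F b x) →
    ∃[ c ] (K ⊆ J S F c × _⊆C_ S F c a × _⊆C_ S F c b)
proposition4p2 S F K compact inhabited a b K⊆J∩J
  with compact⇒finite-basic-subcover S F _ K compact
         (λ x Kx → J∩J⊆⋃CBelow S F a b x (K⊆J∩J x Kx))
... | L , below , K⊆⋃L
  with ⋃I-code S F L (cover-of-inhabited-≢[] S F L inhabited K⊆⋃L)
... | c , ⋃L⊆Jc , c⊆L =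
  c , (λ x Kx → ⋃L⊆Jc x (K⊆⋃L x Kx))
    , All-CBelow⇒⊆C S F (All.map proj₁ below) c⊆L
    , All-CBelow⇒⊆C S F (All.map proj₂ below) c⊆L
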